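{- The only primitive formally dual set of rank one (in any finite abelian group) is $\{1\}$ in the trivial group $G=\{1\}$.
   Context: For a finite abelian group $G$ and a group isomorphism $\Delta:G\to\widehat G$, $y\mapsto\chi_y$, subsets $S,T\subseteq G$ form a formally dual pair if for all $y\in G$: $|\chi_y(S)|^2=\frac{|S|^2}{|T|}\nu_T(y)$ and $|\chi_y(T)|^2=\frac{|T|^2}{|S|}\nu_S(y)$, where $\chi(A)=\sum_{a\in A}\chi(a)$ and $\nu_A(y)=|\{(a_1,a_2)\in A\times A\mid y=a_1a_2^{ -1}\}|$. A subset is primitive if it is not contained in a coset of a proper subgroup and is not a union of cosets of a nontrivial subgroup; $S$ is a primitive formally dual set if there exist such $\Delta$ and $T$ with both $S$ and $T$ primitive. $S$ is an even set if, in the group ring $\mathbb{Z}[G]$, $SS^{(-1)}=\sum_{i=1}^r\lambda_iH_i$ for some subgroups $H_i$ (identified with the sum of their elements) and nonzero integers $\lambda_i$, where $S^{(-1)}=\sum_{s\in S}s^{ -1}$; its rank is the smallest such $r$. -}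

module Defs where

open import Data.Nat as ℕ using (ℕ; zero; suc; _∸_; _<_)
open import Data.Nat.Divisibility using (_∣?_)
open import Data.Nat.DivMod using (_mod_)
open import Data.Integer as ℤ using (ℤ; +_; -_)
open import Data.Fin using (Fin; toℕ; _≟_)
open import Data.Fin.Subset using (Subset; _∈_; _∉_; ∣_∣; Nonempty)
open import Data.Nat.ListAction using (sum)
open import Data.Bool using (Bool; true; false; if_then_else_; _∧_)
open import Data.List as List using (List; []; _∷_; _++_; foldr; map; reverse; length; replicate; zip; upTo; allFin)
open import Data.List.Relation.Unary.All using (All)
open import Data.Vec as Vec using (Vec; lookup)
open import Data.Product using (Σ; ∃; _×_; _,_)
open import Relation.Nullary using (¬_; does)
open import Relation.Binary.PropositionalEquality using (_≡_; _≢_)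
open import Algebra.Core using (Op₁; Op₂)
open import Algebra.Structures using (IsAbelianGroup)

-- Integer polynomials (coefficient lists, lowest degree first)

Poly : Set
Poly = List ℤ

infixl 6 _+ₚ_
infixl 7 _*ₚ_

_+ₚ_ : Poly → Poly → Poly
[]      +ₚ q       = q
(a ∷ p) +ₚ []      = a ∷ p
(a ∷ p) +ₚ (b ∷ q) = (a ℤ.+ b) ∷ (p +ₚ q)

scaleₚ : ℤ → Poly → Poly
scaleₚ c = map (c ℤ.*_)

negₚ : Poly → Poly
negₚ = map (-_)

_*ₚ_ : Poly → Poly → Poly
[]      *ₚ q = []
(a ∷ p) *ₚ q = scaleₚ a q +ₚ (+ 0 ∷ (p *ₚ q))

mono : ℕ → Poly
mono k = replicate k (+ 0) ++ (+ 1 ∷ [])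

-- equality of polynomials (up to trailing zero coefficients)
_≈ₚ_ : Poly → Poly → Set
p ≈ₚ q = All (_≡ + 0) (p +ₚ negₚ q)

-- exact division by a monic polynomial (synthetic division)
private
  subPrefix : ℤ → List ℤ → List ℤ → List ℤ
  subPrefix c []       rs       = rs
  subPrefix c (d ∷ ds) []       = []
  subPrefix c (d ∷ ds) (r ∷ rs) = (r ℤ.- c ℤ.* d) ∷ subPrefix c ds rs

  -- high-degree-first dividend, divisor = 1 ∷ dt (high-degree-first)
  divHF : ℕ → List ℤ → List ℤ → List ℤ
  divHF zero    dt []       = []
  divHF zero    dt (r ∷ rs) = []
  divHF (suc k) dt []       = []
  divHF (suc k) dt (r ∷ rs) with does (length rs ℕ.<? length dt)
  ... | true  = []
  ... | false = r ∷ divHF k dt (subPrefix r dt rs)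

  tailL : List ℤ → List ℤ
  tailL []       = []
  tailL (_ ∷ xs) = xs

divMonic : Poly → Poly → Poly
divMonic p d = reverse (divHF (length p) (tailL (reverse d)) (reverse p))

xⁿ-1 : ℕ → Poly
xⁿ-1 n = mono n +ₚ (- (+ 1) ∷ [])

-- Φ_n = (x^n - 1) / ∏_{d ∣ n, d < n} Φ_d ,  given prev = [Φ_1, …, Φ_{n-1}]
private
  newΦ : ℕ → List Poly → Poly
  newΦ n prev = divMonic (xⁿ-1 n)
    (foldr (λ { (d , φ) acc → if does (d ∣? n) then φ *ₚ acc else acc })
           (+ 1 ∷ [])
           (zip (map suc (upTo (length prev))) prev))

cyclotomics : ℕ → List Poly
cyclotomics zero    = []
cyclotomics (suc k) = cyclotomics k ++ (newΦ (suc k) (cyclotomics k) ∷ [])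

-- the n-th cyclotomic polynomial Φ_n (n ≥ 1), the minimal polynomial of ζ_n = e^{2πi/n}
Φ : ℕ → Poly
Φ zero    = []
Φ (suc k) = newΦ (suc k) (cyclotomics k)

-- P(ζ_n) = 0 in ℂ, for P ∈ ℤ[x]
VanishesAtζ : ℕ → Poly → Set
VanishesAtζ n P = ∃ λ (Q : Poly) → P ≈ₚ (Q *ₚ Φ n)

record FinAbGroup (n : ℕ) : Set where
  infixl 7 _∙_
  infix 8 _⁻¹
  field
    _∙_ : Op₂ (Fin n)
    ε   : Fin n
    _⁻¹ : Op₁ (Fin n)
    isAbelianGroup : IsAbelianGroup _≡_ _∙_ ε _⁻¹

sumFin : ∀ {n} → (Fin n → ℕ) → ℕ
sumFin {n} f = sum (map f (allFin n))

sumFinP : ∀ {n} → (Fin n → Poly) → Poly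
sumFinP {n} f = foldr _+ₚ_ [] (map f (allFin n))

module _ {m : ℕ} (G : FinAbGroup (suc m)) where
  open FinAbGroup G

  private
    n : ℕ
    n = suc m

  _+ₙ_ : Fin n → Fin n → Fin n
  a +ₙ b = (toℕ a ℕ.+ toℕ b) mod n

  -- characters of G: homomorphisms G → ℤ/n, the character being g ↦ ζ_n^{f g}
  -- (every character of G takes values in the n-th roots of unity, n = |G|)
  IsCharacter : (Fin n → Fin n) → Set
  IsCharacter f = ∀ a b → f (a ∙ b) ≡ f a +ₙ f b

  IsDualIso : (Fin n → Fin n → Fin n) → Set
  IsDualIso Δ =
    (∀ y → IsCharacter (Δ y)) ×
    (∀ y z a → Δ (y ∙ z) a ≡ Δ y a +ₙ Δ z a) ×
    (∀ y z → (∀ a → Δ y a ≡ Δ z a) → y ≡ z) ×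
    (∀ f → IsCharacter f → ∃ λ y → ∀ a → Δ y a ≡ f a)

  -- χ_y(A) as the element Σ_{a∈A} x^{χ_y(a)} of ℤ[x] (evaluated at ζ_n)
  charSum : (Fin n → Fin n → Fin n) → Fin n → Subset n → Poly
  charSum Δ y A = sumFinP (λ a → if lookup A a then mono (toℕ (Δ y a)) else [])

  -- its complex conjugate: ζ_n^{-k} = ζ_n^{n-k}
  charSumConj : (Fin n → Fin n → Fin n) → Fin n → Subset n → Poly
  charSumConj Δ y A = sumFinP (λ a → if lookup A a then mono (n ∸ toℕ (Δ y a)) else [])

  ν : Subset n → Fin n → ℕ
  ν A y = sumFin (λ a₁ → sumFin (λ a₂ →
            if lookup A a₁ ∧ lookup A a₂ ∧ does (y ≟ a₁ ∙ a₂ ⁻¹) then 1 else 0))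

  -- |T| · |χ_y(S)|² = |S|² · ν_T(y)   (i.e. |χ_y(S)|² = |S|²/|T| ν_T(y))
  DualCondition : (Fin n → Fin n → Fin n) → Subset n → Subset n → Fin n → Set
  DualCondition Δ S T y =
    VanishesAtζ n (scaleₚ (+ ∣ T ∣) (charSum Δ y S *ₚ charSumConj Δ y S)
                   +ₚ negₚ (+ (∣ S ∣ ℕ.* ∣ S ∣ ℕ.* ν T y) ∷ []))

  IsFormallyDualPair : (Fin n → Fin n → Fin n) → Subset n → Subset n → Set
  IsFormallyDualPair Δ S T =
    Nonempty S × Nonempty T ×
    (∀ y → DualCondition Δ S T y) × (∀ y → DualCondition Δ T S y)

  IsSubgroup : Subset n → Set
  IsSubgroup H = (ε ∈ H) × (∀ a b → a ∈ H → b ∈ H → a ∙ b ∈ H) × (∀ a → a ∈ H → a ⁻¹ ∈ H)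

  InCosetOfProperSubgroup : Subset n → Set
  InCosetOfProperSubgroup A = ∃ λ H → IsSubgroup H × (∃ λ x → x ∉ H) ×
    ∃ λ g → ∀ s → s ∈ A → ∃ λ h → h ∈ H × s ≡ g ∙ h

  UnionOfCosetsOfNontrivialSubgroup : Subset n → Set
  UnionOfCosetsOfNontrivialSubgroup A = ∃ λ H → IsSubgroup H × (∃ λ h → h ∈ H × h ≢ ε) ×
    ∃ λ X → ∀ s → (s ∈ A → ∃ λ g → ∃ λ h → g ∈ X × h ∈ H × s ≡ g ∙ h) ×
                  ((∃ λ g → ∃ λ h → g ∈ X × h ∈ H × s ≡ g ∙ h) → s ∈ A)

  IsPrimitive : Subset n → Set
  IsPrimitive A = ¬ InCosetOfProperSubgroup A × ¬ UnionOfCosetsOfNontrivialSubgroup A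

  IsPrimitiveFormallyDual : Subset n → Set
  IsPrimitiveFormallyDual S = ∃ λ Δ → IsDualIso Δ × ∃ λ T →
    IsFormallyDualPair Δ S T × IsPrimitive S × IsPrimitive T

  -- SS^{(-1)} (its coefficient at g is ν_S(g)) = Σ_{i<r} λ_i H_i with subgroups H_i, λ_i ≠ 0
  EvenWith : ℕ → Subset n → Set
  EvenWith r S = ∃ λ (c : Vec (ℤ × Subset n) r) →
    (∀ i → let (l , H) = lookup c i in l ≢ + 0 × IsSubgroup H) ×
    (∀ g → + ν S g ≡ Vec.foldr _ ℤ._+_ (+ 0)
              (Vec.map (λ { (l , H) → if lookup H g then l else + 0 }) c))

  HasRank : ℕ → Subset n → Set
  HasRank r S = EvenWith r S × (∀ r′ → r′ < r → ¬ EvenWith r′ S)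

{-# OPTIONS --safe #-}
module Submission where

-- Rank one means ν_S = λ·1_H for a single subgroup H. For a, b ∈ S the pair (a, b) is counted
-- in ν_S(ab⁻¹), so all quotients of S lie in H; then S lies in a coset of H, and primitivity
-- forces H = G. Hence ν_S(g) = |S ∩ gS| is constant, equal to ν_S(1) = |S|, so gS = S for
-- every g: S is a union of cosets of G itself, which primitivity allows only when G is
-- trivial. Formal duality is used only through S ≠ ∅. Conversely, in the trivial group {1}
-- is formally dual to itself and {1}{1}⁻¹ = 1·G.

open import Defs
open import Level using (0ℓ)
open import Function using (_∘_; id)
open import Data.Nat using (ℕ; zero; suc; _+_; _≤_; _<_; z≤n; s≤s)
open import Data.Nat.Properties
  using (≤-refl; ≤-trans; +-mono-≤; +-mono-<-≤; +-mono-≤-<; m≤m+n; m≤n+m; +-identityʳ; <⇒≢)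
open import Data.Nat.ListAction using (sum)
open import Data.Integer as ℤ using (+_)
open import Data.Integer.Properties using (+-injective)
open import Data.Fin as Fin using (Fin; _≟_)
open import Data.Fin.Properties using (suc-injective)
open import Data.Fin.Subset using (Subset; ⁅_⁆; _∈_; Nonempty; ⊤)
open import Data.Fin.Subset.Properties using (_∈?_; ∈⊤; x∈⁅x⁆; ⊆-antisym)
open import Data.Bool using (true; false; if_then_else_; _∧_)
open import Data.Bool.Properties using (∧-zeroʳ; ∧-identityʳ)
open import Data.List as List using (allFin)
open import Data.List.Properties using (map-cong; map-tabulate)
open import Data.List.Relation.Unary.All using () renaming ([] to []ᴬ; _∷_ to _∷ᴬ_)
open import Data.Vec using (lookup; []; _∷_)
open import Data.Vec.Properties using ([]=⇒lookup; lookup⇒[]=)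
open import Data.Product using (_×_; ∃; _,_; proj₂; map₁)
open import Relation.Nullary using (¬_; yes; no; does; contradiction)
open import Relation.Nullary.Decidable using (dec-true; dec-false)
open import Relation.Binary.PropositionalEquality
  using (_≡_; _≢_; ≢-sym; _≗_; refl; sym; trans; cong; subst; module ≡-Reasoning)
open import Algebra.Bundles using (AbelianGroup)
open import Algebra.Structures using (IsAbelianGroup; IsGroup)
import Algebra.Properties.AbelianGroup as AbelianGroupProperties
import Algebra.Properties.Loop as LoopProperties

sumFin-suc : ∀ {n} (f : Fin (suc n) → ℕ) → sumFin f ≡ f Fin.zero + sumFin (f ∘ Fin.suc)
sumFin-suc f = cong (λ xs → f Fin.zero + sum xs)
  (trans (map-tabulate Fin.suc f) (sym (map-tabulate id (f ∘ Fin.suc))))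

sumFin-cong : ∀ {n} {f h : Fin n → ℕ} → f ≗ h → sumFin f ≡ sumFin h
sumFin-cong {n} f≗h = cong sum (map-cong f≗h (allFin n))

sumFin-zero : ∀ {n} {f : Fin n → ℕ} → (∀ a → f a ≡ 0) → sumFin f ≡ 0
sumFin-zero {zero}      _     = refl
sumFin-zero {suc n} {f} f≡0 rewrite sumFin-suc f | f≡0 Fin.zero = sumFin-zero (f≡0 ∘ Fin.suc)

sumFin-single : ∀ {n} {f : Fin n → ℕ} c → (∀ a → a ≢ c → f a ≡ 0) → sumFin f ≡ f c
sumFin-single {suc n} {f} Fin.zero off rewrite sumFin-suc f
  | sumFin-zero {f = f ∘ Fin.suc} (λ a → off (Fin.suc a) λ ()) = +-identityʳ (f Fin.zero)
sumFin-single {suc n} {f} (Fin.suc c) off rewrite sumFin-suc f | off Fin.zero (λ ()) =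
  sumFin-single c (λ a a≢c → off (Fin.suc a) (a≢c ∘ suc-injective))

≤-sumFin : ∀ {n} (f : Fin n → ℕ) c → f c ≤ sumFin f
≤-sumFin f Fin.zero    rewrite sumFin-suc f = m≤m+n _ _
≤-sumFin f (Fin.suc c) rewrite sumFin-suc f = ≤-trans (≤-sumFin (f ∘ Fin.suc) c) (m≤n+m _ _)

sumFin-mono-≤ : ∀ {n} {f h : Fin n → ℕ} → (∀ a → f a ≤ h a) → sumFin f ≤ sumFin h
sumFin-mono-≤ {zero}          _   = z≤n
sumFin-mono-≤ {suc n} {f} {h} f≤h rewrite sumFin-suc f | sumFin-suc h =
  +-mono-≤ (f≤h Fin.zero) (sumFin-mono-≤ (f≤h ∘ Fin.suc))

sumFin-mono-< : ∀ {n} {f h : Fin n → ℕ} → (∀ a → f a ≤ h a) →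
                ∀ c → f c < h c → sumFin f < sumFin h
sumFin-mono-< {f = f} {h} f≤h Fin.zero fc<hc rewrite sumFin-suc f | sumFin-suc h =
  +-mono-<-≤ fc<hc (sumFin-mono-≤ (f≤h ∘ Fin.suc))
sumFin-mono-< {f = f} {h} f≤h (Fin.suc c) fc<hc rewrite sumFin-suc f | sumFin-suc h =
  +-mono-≤-< (f≤h Fin.zero) (sumFin-mono-< (f≤h ∘ Fin.suc) c fc<hc)

Fin1-unique : (x y : Fin 1) → x ≡ y
Fin1-unique Fin.zero Fin.zero = refl

all-equal⇒≡0 : ∀ {m} {e : Fin (suc m)} → (∀ x → x ≡ e) → m ≡ 0
all-equal⇒≡0 {zero}  _     = refl
all-equal⇒≡0 {suc m} ≡e with trans (≡e Fin.zero) (sym (≡e (Fin.suc Fin.zero)))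
... | ()

module _ {m : ℕ} (G : FinAbGroup (suc m)) where
  open FinAbGroup G
  open IsAbelianGroup isAbelianGroup using (isGroup; comm; identityʳ)
  open IsGroup isGroup using (_\\_; _//_)

  private
    abelianGroup : AbelianGroup 0ℓ 0ℓ
    abelianGroup = record { isAbelianGroup = isAbelianGroup }

  open AbelianGroupProperties abelianGroup
    using (y≈x\\z; x≈z//y; //-rightDividesˡ; \\-leftDividesˡ; comm⇒\\≗flip-//; ⁻¹-involutive; loop)
  open LoopProperties loop using (ε\\x≈x)

  x≡y//z⇒z≡x\\y : ∀ {x y z} → x ≡ y // z → z ≡ x \\ y
  x≡y//z⇒z≡x\\y {x} {y} {z} refl = y≈x\\z x z y (//-rightDividesˡ z y)

  x≡y//x\\y : ∀ x y → x ≡ y // (x \\ y)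
  x≡y//x\\y x y = x≈z//y x (x \\ y) y (\\-leftDividesˡ x y)

  x∙y≡y⁻¹\\x : ∀ x y → x ∙ y ≡ y ⁻¹ \\ x
  x∙y≡y⁻¹\\x x y = trans (comm x y) (cong (_∙ x) (sym (⁻¹-involutive y)))

  shiftOverlap : Subset (suc m) → Fin (suc m) → ℕ
  shiftOverlap S g = sumFin (λ a → if lookup S a ∧ lookup S (g \\ a) then 1 else 0)

  ν≡shiftOverlap : ∀ S g → ν G S g ≡ shiftOverlap S g
  ν≡shiftOverlap S g =
    sumFin-cong λ a₁ → trans (sumFin-single (g \\ a₁) (off-diagonal a₁)) (diagonal a₁)
    where
    diagonal : ∀ a →
      (if lookup S a ∧ lookup S (g \\ a) ∧ does (g ≟ a // (g \\ a)) then 1 else 0) ≡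
      (if lookup S a ∧ lookup S (g \\ a) then 1 else 0)
    diagonal a rewrite dec-true (g ≟ a // (g \\ a)) (x≡y//x\\y g a)
      | ∧-identityʳ (lookup S (g \\ a)) = refl

    off-diagonal : ∀ a₁ a₂ → a₂ ≢ g \\ a₁ →
      (if lookup S a₁ ∧ lookup S a₂ ∧ does (g ≟ a₁ // a₂) then 1 else 0) ≡ 0
    off-diagonal a₁ a₂ a₂≢ rewrite dec-false (g ≟ a₁ // a₂) (a₂≢ ∘ x≡y//z⇒z≡x\\y)
      | ∧-zeroʳ (lookup S a₂) | ∧-zeroʳ (lookup S a₁) = refl

  0<ν-// : ∀ {S a b} → a ∈ S → b ∈ S → 0 < ν G S (a // b)
  0<ν-// {S} {a} {b} a∈S b∈S rewrite ν≡shiftOverlap S (a // b) = ≤-trans term≡1 (≤-sumFin _ a)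
    where
    term≡1 : 1 ≤ (if lookup S a ∧ lookup S ((a // b) \\ a) then 1 else 0)
    term≡1 rewrite sym (x≡y//z⇒z≡x\\y {a // b} {a} {b} refl)
      | []=⇒lookup a∈S | []=⇒lookup b∈S = ≤-refl

  shiftOverlap≡ε⇒\\∈ : ∀ {S g a} → shiftOverlap S g ≡ shiftOverlap S ε →
                       a ∈ S → g \\ a ∈ S
  shiftOverlap≡ε⇒\\∈ {S} {g} {a} overlap≡ a∈S with lookup S (g \\ a) in ga
  ... | true  = lookup⇒[]= (g \\ a) S ga
  ... | false = contradiction overlap≡ (<⇒≢ (sumFin-mono-< term-≤ a term-<))
    where
    term-≤ : ∀ b → (if lookup S b ∧ lookup S (g \\ b) then 1 else 0) ≤
                   (if lookup S b ∧ lookup S (ε \\ b) then 1 else 0)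
    term-≤ b rewrite ε\\x≈x b with lookup S b | lookup S (g \\ b)
    ... | true  | true  = ≤-refl
    ... | true  | false = z≤n
    ... | false | _     = z≤n

    term-< : (if lookup S a ∧ lookup S (g \\ a) then 1 else 0) <
             (if lookup S a ∧ lookup S (ε \\ a) then 1 else 0)
    term-< rewrite ε\\x≈x a | []=⇒lookup a∈S | ga = ≤-refl

  ⊤-isSubgroup : IsSubgroup G ⊤
  ⊤-isSubgroup = ∈⊤ , (λ _ _ _ _ → ∈⊤) , (λ _ _ → ∈⊤)

  trivial⇒IsPrimitive : (∀ x → x ≡ ε) → ∀ A → IsPrimitive G A
  trivial⇒IsPrimitive trivial A =
    (λ { (H , (ε∈H , _) , (x , x∉H) , _) → x∉H (subst (_∈ H) (sym (trivial x)) ε∈H) }) ,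
    (λ { (_ , _ , (h , _ , h≢ε) , _) → h≢ε (trivial h) })

  nonempty⇒¬EvenWith0 : ∀ {S} → Nonempty S → ¬ EvenWith G 0 S
  nonempty⇒¬EvenWith0 (s , s∈S) ([] , _ , ν≡0) =
    <⇒≢ (0<ν-// s∈S s∈S) (sym (+-injective (ν≡0 (s // s))))

  ¬InCosetOfProperSubgroup⇒full : ∀ {S H} → ¬ InCosetOfProperSubgroup G S → IsSubgroup G H →
    Nonempty S → (∀ {a b} → a ∈ S → b ∈ S → a // b ∈ H) → ∀ x → x ∈ H
  ¬InCosetOfProperSubgroup⇒full {S} {H} ¬coset H≤G (s₀ , s₀∈S) quotients∈H x with x ∈? H
  ... | yes x∈H = x∈H
  ... | no  x∉H = contradiction (H , H≤G , (x , x∉H) , s₀ , S⊆s₀H) ¬coset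
    where
    S⊆s₀H : ∀ s → s ∈ S → ∃ λ h → h ∈ H × s ≡ s₀ ∙ h
    S⊆s₀H s s∈S = s₀ \\ s
                , subst (_∈ H) (sym (comm⇒\\≗flip-// comm s₀ s)) (quotients∈H s∈S s₀∈S)
                , sym (\\-leftDividesˡ s₀ s)

  ¬UnionOfCosets⇒translation-invariant⇒trivial : ∀ {S} →
    ¬ UnionOfCosetsOfNontrivialSubgroup G S →
    (∀ g {a} → a ∈ S → g \\ a ∈ S) → ∀ h → h ≡ ε
  ¬UnionOfCosets⇒translation-invariant⇒trivial {S} ¬union S-invariant h with h ≟ ε
  ... | yes h≡ε = h≡ε
  ... | no  h≢ε = contradiction (⊤ , ⊤-isSubgroup , (h , ∈⊤ , h≢ε) , S , S≡S⊤) ¬union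
    where
    S≡S⊤ : ∀ s → (s ∈ S → ∃ λ g → ∃ λ t → g ∈ S × t ∈ ⊤ × s ≡ g ∙ t) ×
                 ((∃ λ g → ∃ λ t → g ∈ S × t ∈ ⊤ × s ≡ g ∙ t) → s ∈ S)
    S≡S⊤ s = (λ s∈S → s , ε , s∈S , ∈⊤ , sym (identityʳ s))
           , λ { (g , t , g∈S , _ , refl) →
                   subst (_∈ S) (sym (x∙y≡y⁻¹\\x g t)) (S-invariant (t ⁻¹) g∈S) }

  rank-one-primitive⇒trivial : ∀ {S} → Nonempty S → IsPrimitive G S → EvenWith G 1 S →
    (∀ x → x ≡ ε) × S ≡ ⁅ ε ⁆
  rank-one-primitive⇒trivial {S} S≢∅@(s₀ , s₀∈S) (¬coset , ¬union)
                             ((l , H) ∷ [] , H-props , ν≡lH) = trivial , S≡⁅ε⁆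
    where
    ν≡l·1H : ∀ {g b} → lookup H g ≡ b → + ν G S g ≡ (if b then l else + 0) ℤ.+ + 0
    ν≡l·1H {g} refl = ν≡lH g

    quotients∈H : ∀ {a b} → a ∈ S → b ∈ S → a // b ∈ H
    quotients∈H {a} {b} a∈S b∈S with lookup H (a // b) in q
    ... | true  = lookup⇒[]= (a // b) H q
    ... | false = contradiction (+-injective (ν≡l·1H q)) (≢-sym (<⇒≢ (0<ν-// a∈S b∈S)))

    H-full : ∀ x → x ∈ H
    H-full = ¬InCosetOfProperSubgroup⇒full ¬coset (proj₂ (H-props Fin.zero)) S≢∅ quotients∈H

    ν-constant : ∀ g → ν G S g ≡ ν G S ε
    ν-constant g =
      +-injective (trans (ν≡l·1H ([]=⇒lookup (H-full g))) (sym (ν≡l·1H ([]=⇒lookup (H-full ε)))))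

    S-invariant : ∀ g {a} → a ∈ S → g \\ a ∈ S
    S-invariant g = shiftOverlap≡ε⇒\\∈ (begin
      shiftOverlap S g ≡⟨ sym (ν≡shiftOverlap S g) ⟩
      ν G S g          ≡⟨ ν-constant g ⟩
      ν G S ε          ≡⟨ ν≡shiftOverlap S ε ⟩
      shiftOverlap S ε ∎)
      where open ≡-Reasoning

    trivial : ∀ x → x ≡ ε
    trivial = ¬UnionOfCosets⇒translation-invariant⇒trivial ¬union S-invariant

    S≡⁅ε⁆ : S ≡ ⁅ ε ⁆
    S≡⁅ε⁆ = ⊆-antisym (λ {x} _ → subst (_∈ ⁅ ε ⁆) (sym (trivial x)) (x∈⁅x⁆ ε))
                      (λ {x} _ → subst (_∈ S) (trans (trivial s₀) (sym (trivial x))) s₀∈S)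

module _ (G : FinAbGroup 1) where
  open FinAbGroup G using (ε; _∙_; _⁻¹)

  Δ-trivial : Fin 1 → Fin 1 → Fin 1
  Δ-trivial _ _ = Fin.zero

  Δ-trivial-isDualIso : IsDualIso G Δ-trivial
  Δ-trivial-isDualIso = (λ _ _ _ → refl) , (λ _ _ _ → refl) , (λ y z _ → Fin1-unique y z) ,
                        (λ f _ → Fin.zero , λ a → Fin1-unique Fin.zero (f a))

  ⁅0⁆-nonempty : Nonempty {1} ⁅ Fin.zero ⁆
  ⁅0⁆-nonempty = Fin.zero , x∈⁅x⁆ Fin.zero

  ν-⁅0⁆ : ∀ y → ν G ⁅ Fin.zero ⁆ y ≡ 1
  ν-⁅0⁆ y rewrite dec-true (y ≟ Fin.zero ∙ Fin.zero ⁻¹) (Fin1-unique _ _) = refl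

  -- The conjugate of x⁰ is encoded as x^(1 ∸ 0) = x, so the condition reads x − 1 = 1 · Φ₁.
  ⁅0⁆-self-dual : ∀ y → DualCondition G Δ-trivial ⁅ Fin.zero ⁆ ⁅ Fin.zero ⁆ y
  ⁅0⁆-self-dual y rewrite ν-⁅0⁆ y = (+ 1 List.∷ List.[]) , refl ∷ᴬ refl ∷ᴬ []ᴬ

  ⁅0⁆-isPrimitiveFormallyDual : IsPrimitiveFormallyDual G ⁅ Fin.zero ⁆
  ⁅0⁆-isPrimitiveFormallyDual =
    Δ-trivial , Δ-trivial-isDualIso , ⁅ Fin.zero ⁆ ,
    (⁅0⁆-nonempty , ⁅0⁆-nonempty , ⁅0⁆-self-dual , ⁅0⁆-self-dual) ,
    ⁅0⁆-isPrimitive , ⁅0⁆-isPrimitive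
    where
    ⁅0⁆-isPrimitive : IsPrimitive G ⁅ Fin.zero ⁆
    ⁅0⁆-isPrimitive = trivial⇒IsPrimitive G (λ x → Fin1-unique x ε) ⁅ Fin.zero ⁆

  ⁅0⁆-rank-one : HasRank G 1 ⁅ Fin.zero ⁆
  ⁅0⁆-rank-one = ((+ 1 , ⊤) ∷ [] , (λ { Fin.zero → (λ ()) , ⊤-isSubgroup G }) , ν≡1·⊤)
               , λ { zero _ → nonempty⇒¬EvenWith0 G ⁅0⁆-nonempty ; (suc _) (s≤s ()) }
    where
    ν≡1·⊤ : ∀ g → + ν G ⁅ Fin.zero ⁆ g ≡ (if lookup ⊤ g then + 1 else + 0) ℤ.+ + 0
    ν≡1·⊤ Fin.zero = cong +_ (ν-⁅0⁆ Fin.zero)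

singleton-ε-primitive-rank-one : (G : FinAbGroup 1) →
  IsPrimitiveFormallyDual G ⁅ FinAbGroup.ε G ⁆ × HasRank G 1 ⁅ FinAbGroup.ε G ⁆
singleton-ε-primitive-rank-one G =
  subst (λ A → IsPrimitiveFormallyDual G A × HasRank G 1 A)
        (cong ⁅_⁆ (Fin1-unique Fin.zero (FinAbGroup.ε G)))
        (⁅0⁆-isPrimitiveFormallyDual G , ⁅0⁆-rank-one G)

theorem4p16 : (m : ℕ) (G : FinAbGroup (suc m)) (S : Subset (suc m)) →
    ((IsPrimitiveFormallyDual G S × HasRank G 1 S) → (m ≡ 0 × S ≡ ⁅ FinAbGroup.ε G ⁆)) ×
    ((m ≡ 0 × S ≡ ⁅ FinAbGroup.ε G ⁆) → (IsPrimitiveFormallyDual G S × HasRank G 1 S))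
theorem4p16 m G S = primitive-rank-one⇒singleton , singleton⇒primitive-rank-one
  where
  primitive-rank-one⇒singleton :
    IsPrimitiveFormallyDual G S × HasRank G 1 S → m ≡ 0 × S ≡ ⁅ FinAbGroup.ε G ⁆
  primitive-rank-one⇒singleton ((_ , _ , _ , (S≢∅ , _) , S-primitive , _) , (even , _)) =
    map₁ all-equal⇒≡0 (rank-one-primitive⇒trivial G S≢∅ S-primitive even)

  singleton⇒primitive-rank-one :
    m ≡ 0 × S ≡ ⁅ FinAbGroup.ε G ⁆ → IsPrimitiveFormallyDual G S × HasRank G 1 S
  singleton⇒primitive-rank-one (refl , refl) = singleton-ε-primitive-rank-one G
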